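{- Let $G$ be a connected undirected graph with nonnegative edge lengths, and let $V(G)$ be partitioned into sets $L$, $Z$, $R$ such that every path from a vertex of $L$ to a vertex of $R$ contains a vertex of $Z$. Write $Z=\{z_1,\dots,z_k\}$, $X=L\cup Z$ and $Y=R\cup Z$, and assume $Y\neq\emptyset$. For $x\in X$ let $e(x;Y)=\max\{d(x,y): y\in Y\}$, and for $i\in\{1,\dots,k\}$ let $e(x,z_i;Y)$ be the maximum of $l(z_iPy)$ over all $y\in Y$ and all shortest $x,y$-paths $xPy$ such that $z_i\in V(xPy)$ and no shortest $x,y$-path contains any vertex of $\{z_1,\dots,z_{i-1}\}$ (here $z_iPy$ denotes the subpath of $xPy$ from $z_i$ to $y$; the maximum over an empty set is $-\infty$). Then for every $x\in X$, \[ e(x;Y)=\max\{\, d(x,z)+e(x,z;Y) : z\in Z\,\}. \]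
   Context: The length $l(P)$ of a path $P$ is the sum of its edge lengths; $d(u,v)$ is the minimum length of a $u,v$-path; a shortest $u,v$-path is a $u,v$-path of length $d(u,v)$.
   Formalization: The edge lengths are nonnegative rationals, so the distances $d(u,v)$ and the values $e(x;Y)$ and $e(x,z_i;Y)$ are rational as well. -}

module Defs where

open import Data.Nat using (ℕ)
open import Data.Fin using (Fin; _≟_) renaming (_<_ to _<ᶠ_)
open import Data.Rational using (ℚ; 0ℚ; _+_; _≤_)
open import Data.List using (List; []; _∷_)
open import Data.List.Membership.Propositional using (_∈_; _∉_)
open import Data.List.Relation.Unary.Unique.Propositional using (Unique)
open import Data.Maybe using (Maybe; just; nothing)
open import Data.Product using (Σ; ∃; ∃-syntax; _×_)
open import Data.Sum using (_⊎_)
open import Relation.Nullary using (¬_; yes; no)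
open import Relation.Binary.PropositionalEquality using (_≡_; _≢_)

record Graph (n : ℕ) : Set₁ where
  field
    Adj      : Fin n → Fin n → Set
    adj-sym  : ∀ {u v} → Adj u v → Adj v u
    len      : Fin n → Fin n → ℚ          -- length of the edge uv (only used on edges)
    len-sym  : ∀ {u v} → Adj u v → len u v ≡ len v u
    len-nonneg : ∀ {u v} → Adj u v → 0ℚ ≤ len u v

module _ {n : ℕ} (G : Graph n) where
  open Graph G

  data Walk : Fin n → Fin n → List (Fin n) → Set where
    single : ∀ v → Walk v v (v ∷ [])
    step   : ∀ {u w v vs} → Adj u w → Walk w v (w ∷ vs) → Walk u v (u ∷ w ∷ vs)

  IsPath : Fin n → Fin n → List (Fin n) → Set
  IsPath u v P = Walk u v P × Unique P

  l : List (Fin n) → ℚ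
  l (a ∷ b ∷ rest) = len a b + l (b ∷ rest)
  l _ = 0ℚ

  IsDist : Fin n → Fin n → ℚ → Set
  IsDist u v r = (Σ (List (Fin n)) λ P → IsPath u v P × l P ≡ r)
               × (∀ P → IsPath u v P → r ≤ l P)

  Connected : Set
  Connected = ∀ u v → Σ (List (Fin n)) λ P → IsPath u v P

suffixFrom : ∀ {n} → Fin n → List (Fin n) → List (Fin n)
suffixFrom z [] = []
suffixFrom z (a ∷ as) with a ≟ z
... | yes _ = a ∷ as
... | no _  = suffixFrom z as

data Side : Set where
  inL inZ inR : Side

-- ℚ extended with -∞ (= nothing)
ℚ∞ : Set
ℚ∞ = Maybe ℚ

data _≤∞_ : ℚ∞ → ℚ∞ → Set where
  -∞≤ : ∀ {m} → nothing ≤∞ m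
  fin≤ : ∀ {a b} → a ≤ b → just a ≤∞ just b

_+∞_ : ℚ → ℚ∞ → ℚ∞
a +∞ just b = just (a + b)
a +∞ nothing = nothing

IsMaxOrBot : (ℚ → Set) → ℚ∞ → Set
IsMaxOrBot S nothing = ∀ r → ¬ S r
IsMaxOrBot S (just m) = S m × (∀ r → S r → r ≤ m)

IsMax∞ : (ℚ∞ → Set) → ℚ∞ → Set
IsMax∞ T m = T m × (∀ v → T v → v ≤∞ m)

IsMax : (ℚ → Set) → ℚ → Set
IsMax S m = S m × (∀ r → S r → r ≤ m)

module Setup {n k : ℕ} (G : Graph n) (lab : Fin n → Side) (z : Fin k → Fin n)
             (d : Fin n → Fin n → ℚ) where

  InX : Fin n → Set
  InX v = lab v ≢ inR

  InY : Fin n → Set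
  InY v = lab v ≢ inL

  ShortestPath : Fin n → Fin n → List (Fin n) → Set
  ShortestPath x y P = IsPath G x y P × l G P ≡ d x y

  EccSet : Fin n → ℚ → Set
  EccSet x r = ∃[ y ] (InY y × r ≡ d x y)

  EccZSet : Fin n → Fin k → ℚ → Set
  EccZSet x i r =
    ∃[ y ] (InY y × Σ (List (Fin n)) λ P →
      ShortestPath x y P × z i ∈ P
      × (∀ j → j <ᶠ i → ∀ Q → ShortestPath x y Q → z j ∉ Q)
      × r ≡ l G (suffixFrom (z i) P))

  RHSSet : Fin n → (Fin k → ℚ∞) → ℚ∞ → Set
  RHSSet x eZ v = ∃[ i ] (v ≡ d x (z i) +∞ eZ i)

{-# OPTIONS --safe #-}
-- Cutting a shortest x,y-path at a vertex z_i leaves a shortest x,z_i-path, so every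
-- admissible value l(z_i P y) satisfies d(x,z_i) + l(z_i P y) = d(x,y) ≤ e(x;Y).
-- Conversely, let y ∈ Y attain e(x;Y). A shortest x,y-path meets Z (at x, at y, or by
-- separation), so there is a least i such that some shortest x,y-path passes through z_i;
-- that path is admissible for e(x,z_i;Y), whence e(x;Y) ≤ d(x,z_i) + e(x,z_i;Y).
module Submission where

open import Defs
open import Data.Nat using (ℕ)
open import Data.Fin using (Fin) renaming (_≟_ to _≟ᶠ_; _<_ to _<ᶠ_)
open import Data.Fin.Induction using (<-wellFounded)
open import Data.Fin.Properties using (any?)
open import Data.Rational using (ℚ; 0ℚ; _+_; _≤_)
import Data.Rational.Properties as ℚ
open import Data.List using (List; []; _∷_)
open import Data.List.Membership.Propositional using (_∈_)
open import Data.List.Relation.Unary.Any using (here; there)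
open import Data.List.Relation.Unary.All using ([])
open import Data.List.Relation.Unary.All.Properties using (¬Any⇒All¬)
open import Data.List.Relation.Unary.AllPairs using ([]; _∷_)
open import Data.List.Relation.Unary.Unique.Propositional using (Unique)
import Data.List.Membership.DecPropositional as DecMembership
open import Data.Maybe using (just; nothing)
open import Data.Maybe.Properties using (≡-dec)
open import Data.Product using (Σ; ∃; ∃-syntax; _×_; _,_)
open import Data.Empty using (⊥-elim)
open import Function using (Injective; _⇔_)
open import Function.Bundles using (Equivalence)
open import Induction.WellFounded using (module All)
open import Relation.Unary using (Pred)
open import Relation.Nullary using (¬_; yes; no)
open import Relation.Nullary.Decidable using (decidable-stable)
open import Relation.Binary.PropositionalEquality using (_≡_; _≢_; refl; sym; trans; cong)

¬¬-least : ∀ {k p} {Q : Pred (Fin k) p} → ∃ Q →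
           ¬ ¬ (∃[ i ] (Q i × (∀ j → j <ᶠ i → ¬ Q j)))
¬¬-least {Q = Q} (i , qi) noLeast = never-Q i qi
  where
  never-Q : ∀ i → ¬ Q i
  never-Q = All.wfRec <-wellFounded _ (λ i → ¬ Q i)
              (λ i below qi → noLeast (i , qi , λ j j<i → below j<i))

maxOrBot-of-inhabited : ∀ {S : ℚ → Set} {e r} → IsMaxOrBot S e → S r →
                        ∃[ m ] (e ≡ just m × S m × r ≤ m)
maxOrBot-of-inhabited {e = nothing} none     sr = ⊥-elim (none _ sr)
maxOrBot-of-inhabited {e = just m}  (m∈ , max) sr = m , refl , m∈ , max _ sr

p≤q+p : ∀ {p q} → 0ℚ ≤ q → p ≤ q + p
p≤q+p {p} 0≤q = ℚ.≤-trans (ℚ.≤-reflexive (sym (ℚ.+-identityˡ p))) (ℚ.+-monoˡ-≤ p 0≤q)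

module Walks {n : ℕ} (G : Graph n) where
  open Graph G
  open ℚ.≤-Reasoning
  open DecMembership (_≟ᶠ_ {n}) using (_∈?_)

  step′ : ∀ {u w v R} → Adj u w → Walk G w v R → Walk G u v (u ∷ R)
  step′ a (single w) = step a (single w)
  step′ a (step b W) = step a (step b W)

  l-step′ : ∀ {u w v R} → Walk G w v R → l G (u ∷ R) ≡ len u w + l G R
  l-step′ (single _) = refl
  l-step′ (step _ _) = refl

  l-nonneg : ∀ {u v P} → Walk G u v P → 0ℚ ≤ l G P
  l-nonneg (single _) = ℚ.≤-refl
  l-nonneg (step a W) = ℚ.+-mono-≤ (len-nonneg a) (l-nonneg W)

  walk-start∈ : ∀ {u v P} → Walk G u v P → u ∈ P
  walk-start∈ (single _) = here refl
  walk-start∈ (step _ _) = here refl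

  walk-end∈ : ∀ {u v P} → Walk G u v P → v ∈ P
  walk-end∈ (single _) = here refl
  walk-end∈ (step _ W) = there (walk-end∈ W)

  walk-++ : ∀ {u w v P Q} → Walk G u w P → Walk G w v Q →
            Σ (List (Fin n)) λ R → Walk G u v R × l G R ≡ l G P + l G Q
  walk-++ (single _) W = _ , W , sym (ℚ.+-identityˡ _)
  walk-++ {Q = Q} (step {u} {w} {_} {ws} a W₁) W₂ with walk-++ W₁ W₂
  ... | R , W , lR = _ , step′ a W , (begin-equality
    l G (u ∷ R)                         ≡⟨ l-step′ W ⟩
    len u w + l G R                     ≡⟨ cong (len u w +_) lR ⟩
    len u w + (l G (w ∷ ws) + l G Q)    ≡⟨ ℚ.+-assoc (len u w) _ _ ⟨
    l G (u ∷ w ∷ ws) + l G Q            ∎)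

  walk-split : ∀ {u v P z} → Walk G u v P → z ∈ P →
               Σ (List (Fin n)) λ pre → Walk G u z pre × Walk G z v (suffixFrom z P)
                 × l G P ≡ l G pre + l G (suffixFrom z P)
  walk-split (single v) (here refl) with v ≟ᶠ v
  ... | yes _  = _ , single v , single v , sym (ℚ.+-identityˡ _)
  ... | no v≢v = ⊥-elim (v≢v refl)
  walk-split {z = z} (step {u} a W) _ with u ≟ᶠ z
  ... | yes refl = _ , single u , step a W , sym (ℚ.+-identityˡ _)
  walk-split (step _ _) (here refl) | no u≢z = ⊥-elim (u≢z refl)
  walk-split {z = z} (step {u} {w} {_} {ws} a W) (there z∈P) | no _
    with walk-split W z∈P
  ... | pre , W₁ , W₂ , lP = _ , step′ a W₁ , W₂ , (begin-equality
    len u w + l G (w ∷ ws)               ≡⟨ cong (len u w +_) lP ⟩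
    len u w + (l G pre + l G suf)        ≡⟨ ℚ.+-assoc (len u w) _ _ ⟨
    (len u w + l G pre) + l G suf        ≡⟨ cong (_+ l G suf) (l-step′ W₁) ⟨
    l G (u ∷ pre) + l G suf              ∎)
    where suf = suffixFrom z (w ∷ ws)

  suffixFrom-unique : (z : Fin n) {P : List (Fin n)} → Unique P → Unique (suffixFrom z P)
  suffixFrom-unique z {[]} U = U
  suffixFrom-unique z {a ∷ P} U with a ≟ᶠ z
  suffixFrom-unique z {a ∷ P} U       | yes _ = U
  suffixFrom-unique z {a ∷ P} (_ ∷ U) | no _  = suffixFrom-unique z U

  shortcut : ∀ {u v W} → Walk G u v W →
             Σ (List (Fin n)) λ P → IsPath G u v P × l G P ≤ l G W
  shortcut (single v) = _ , (single v , [] ∷ []) , ℚ.≤-refl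
  shortcut (step {u} {w} {_} {ws} a W) with shortcut W
  ... | P , (WP , uniqueP) , lP≤ with u ∈? P
  ... | no u∉P = _ , (step′ a WP , ¬Any⇒All¬ P u∉P ∷ uniqueP) , (begin
    l G (u ∷ P)            ≡⟨ l-step′ WP ⟩
    len u w + l G P        ≤⟨ ℚ.+-monoʳ-≤ (len u w) lP≤ ⟩
    len u w + l G (w ∷ ws) ∎)
  ... | yes u∈P with walk-split WP u∈P
  ... | pre , Wpre , Wsuf , lP = _ , (Wsuf , suffixFrom-unique u uniqueP) , (begin
    l G (suffixFrom u P)               ≤⟨ p≤q+p (l-nonneg Wpre) ⟩
    l G pre + l G (suffixFrom u P)     ≡⟨ lP ⟨
    l G P                                    ≤⟨ lP≤ ⟩
    l G (w ∷ ws)                       ≤⟨ p≤q+p (len-nonneg a) ⟩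
    len u w + l G (w ∷ ws)             ∎)

  dist-≤-walk : ∀ {u v r W} → IsDist G u v r → Walk G u v W → r ≤ l G W
  dist-≤-walk (_ , minimal) W with shortcut W
  ... | P , isPath , lP≤ = ℚ.≤-trans (minimal P isPath) lP≤

  dist-via-suffix : ∀ {x y z a b P} → IsDist G x z a → IsDist G x y b →
                    Walk G x y P → l G P ≡ b → z ∈ P → a + l G (suffixFrom z P) ≡ b
  dist-via-suffix {z = z} {a} {b} {P} dxz@((Q , (WQ , _) , lQ) , _) dxy W lP z∈P
    with walk-split W z∈P
  ... | pre , Wpre , Wsuf , lP-split = ℚ.≤-antisym a+suf≤b b≤a+suf
    where
    a+suf≤b : a + l G (suffixFrom z P) ≤ b
    a+suf≤b = begin
      a + l G (suffixFrom z P)         ≤⟨ ℚ.+-monoˡ-≤ _ (dist-≤-walk dxz Wpre) ⟩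
      l G pre + l G (suffixFrom z P)   ≡⟨ trans (sym lP-split) lP ⟩
      b                                      ∎
    b≤a+suf : b ≤ a + l G (suffixFrom z P)
    b≤a+suf with walk-++ WQ Wsuf
    ... | R , WR , lR = begin
      b                                      ≤⟨ dist-≤-walk dxy WR ⟩
      l G R                                  ≡⟨ trans lR (cong (_+ _) lQ) ⟩
      a + l G (suffixFrom z P)         ∎

  Separates : (Fin n → Side) → Set
  Separates lab = ∀ u v P → IsPath G u v P → lab u ≡ inL → lab v ≡ inR →
                  ∃[ w ] (w ∈ P × lab w ≡ inZ)

  path-meets-Z : (lab : Fin n → Side) → Separates lab →
                 ∀ {x y P} → lab x ≢ inR → lab y ≢ inL → IsPath G x y P →
                 ∃[ w ] (w ∈ P × lab w ≡ inZ)
  path-meets-Z lab separates {x} {y} {P} x∉R y∉L p@(W , _) with lab x in eqx | lab y in eqy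
  ... | inZ | _   = x , walk-start∈ W , eqx
  ... | _   | inZ = y , walk-end∈ W , eqy
  ... | inL | inR = separates x y P p eqx eqy
  ... | inR | _   = ⊥-elim (x∉R refl)
  ... | _   | inL = ⊥-elim (y∉L refl)

module Eccentricity {n k : ℕ} (G : Graph n) (lab : Fin n → Side) (z : Fin k → Fin n)
                    (d : Fin n → Fin n → ℚ) (dist : ∀ u v → IsDist G u v (d u v))
                    (x : Fin n) where
  open Setup G lab z d
  open Walks G
  open ℚ.≤-Reasoning

  ShortestThrough : Fin n → Fin k → Set
  ShortestThrough y i = ∃[ P ] (ShortestPath x y P × z i ∈ P)

  shortestPath-via : ∀ {y P i} → ShortestPath x y P → z i ∈ P →
                     d x (z i) + l G (suffixFrom (z i) P) ≡ d x y
  shortestPath-via {y} {i = i} ((W , _) , lP) = dist-via-suffix (dist x (z i)) (dist x y) W lP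

  eccZ-term-≤ : ∀ {e i r} → (∀ r → EccSet x r → r ≤ e) → EccZSet x i r → d x (z i) + r ≤ e
  eccZ-term-≤ ecc≤ (y , y∈Y , P , sp , zi∈P , _ , refl) =
    ℚ.≤-trans (ℚ.≤-reflexive (shortestPath-via sp zi∈P)) (ecc≤ _ (y , y∈Y , refl))

  rhs-≤-ecc : ∀ {e} {eZ : Fin k → ℚ∞} → (∀ r → EccSet x r → r ≤ e) →
              (∀ i → IsMaxOrBot (EccZSet x i) (eZ i)) → ∀ v → RHSSet x eZ v → v ≤∞ just e
  rhs-≤-ecc {eZ = eZ} ecc≤ eZ-max _ (i , refl) with eZ i | eZ-max i
  ... | nothing | _        = -∞≤
  ... | just m  | (m∈ , _) = fin≤ (eccZ-term-≤ ecc≤ m∈)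

  shortestThrough-some : Separates lab → (∀ v → lab v ≡ inZ → ∃[ i ] (z i ≡ v)) →
                         ∀ {y} → InX x → InY y → ∃ (ShortestThrough y)
  shortestThrough-some separates Z⊆z {y} x∈X y∈Y with dist x y
  ... | (P , isPath , lP) , _ with path-meets-Z lab separates x∈X y∈Y isPath
  ... | w , w∈P , w∈Z with Z⊆z w w∈Z
  ... | i , refl = i , P , (isPath , lP) , w∈P

  least-shortestThrough-attains : ∀ {y i} {eZ : Fin k → ℚ∞} →
    (∀ r → EccSet x r → r ≤ d x y) → (∀ i → IsMaxOrBot (EccZSet x i) (eZ i)) → InY y →
    ShortestThrough y i → (∀ j → j <ᶠ i → ¬ ShortestThrough y j) →
    just (d x y) ≡ d x (z i) +∞ eZ i
  least-shortestThrough-attains {y} {i} {eZ} ecc≤ eZ-max y∈Y (P , sp , zi∈P) none-earlier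
    with maxOrBot-of-inhabited (eZ-max i) admissible
    where
    admissible : EccZSet x i (l G (suffixFrom (z i) P))
    admissible = y , y∈Y , P , sp , zi∈P ,
                 (λ j j<i Q spQ zj∈Q → none-earlier j j<i (Q , spQ , zj∈Q)) , refl
  ... | m , eZi≡m , m∈ , suf≤m rewrite eZi≡m = cong just (ℚ.≤-antisym
    (begin
      d x y                                   ≡⟨ shortestPath-via sp zi∈P ⟨
      d x (z i) + l G (suffixFrom (z i) P)    ≤⟨ ℚ.+-monoʳ-≤ (d x (z i)) suf≤m ⟩
      d x (z i) + m                           ∎)
    (eccZ-term-≤ ecc≤ m∈))

lemma10 : {n k : ℕ} (G : Graph n) (lab : Fin n → Side) (z : Fin k → Fin n)
          (d : Fin n → Fin n → ℚ) →
          Connected G →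
          Injective _≡_ _≡_ z →
          (∀ v → (lab v ≡ inZ) ⇔ (∃[ i ] (z i ≡ v))) →
          (∀ u v P → IsPath G u v P → lab u ≡ inL → lab v ≡ inR →
            ∃[ w ] (w ∈ P × lab w ≡ inZ)) →
          (∃[ y ] (lab y ≢ inL)) →
          (∀ u v → IsDist G u v (d u v)) →
          ∀ x → Setup.InX G lab z d x →
          (eY : ℚ) → IsMax (Setup.EccSet G lab z d x) eY →
          (eZ : Fin k → ℚ∞) → (∀ i → IsMaxOrBot (Setup.EccZSet G lab z d x i) (eZ i)) →
          IsMax∞ (Setup.RHSSet G lab z d x eZ) (just eY)
lemma10 G lab z d _ _ Z⇔z separates _ dist x x∈X eY (eY∈ , ecc≤) eZ eZ-max =
  attained eY∈ ecc≤ , rhs-≤-ecc ecc≤ eZ-max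
  where
  open Setup G lab z d
  open Eccentricity G lab z d dist x

  -- Passing through z_i is not decidable, so the least such i exists only under ¬¬;
  -- the goal is decidable, hence stable.
  attained : ∀ {e} → EccSet x e → (∀ r → EccSet x r → r ≤ e) → RHSSet x eZ (just e)
  attained (y , y∈Y , refl) ecc≤ =
    decidable-stable (any? λ i → ≡-dec ℚ._≟_ _ _) λ ¬attained →
    ¬¬-least (shortestThrough-some separates (λ v → Equivalence.to (Z⇔z v)) x∈X y∈Y)
      λ (i , through , least) →
        ¬attained (i , least-shortestThrough-attains ecc≤ eZ-max y∈Y through least)
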